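{- For all positive integers $k,n$ with $n\geq 3k$ we have $$\sum\prod_{i=1}^k\frac{1}{a_i}\leq \frac{k}{n}(\log n)^{k-1},$$ where the sum is over all ordered $k$-tuples $(a_1,\dots,a_k)$ of integers with $a_1+\dots+a_k=n$ and $a_i\geq 3$ for each $i\in[k]$.
   Context: $\log$ is the natural logarithm. -}

module Defs where

open import Data.Nat as ℕ using (ℕ; zero; suc; _!)
open import Data.Nat.Base using (_≤ᵇ_; _≡ᵇ_)
open import Data.Bool using (Bool; true; false; _∧_)
open import Data.Integer using (+_)
open import Data.Rational using (ℚ; 0ℚ; 1ℚ; _+_; _*_; _/_; _≤_; _<_)
open import Data.List using (List; []; _∷_; map; concatMap; upTo; filter; foldr)
open import Data.Vec as Vec using (Vec; []; _∷_)
open import Relation.Nullary.Decidable using (Dec)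
open import Data.Bool using (T)
open import Relation.Nullary.Decidable using (T?)
open import Data.Product using (∃)

-- reciprocal of a natural number as a rational (value at 0 is irrelevant:
-- it is only applied to numbers ≥ 3 and to factorials)
recip : ℕ → ℚ
recip zero    = 0ℚ
recip (suc m) = + 1 / suc m

_^ℚ_ : ℚ → ℕ → ℚ
q ^ℚ zero  = 1ℚ
q ^ℚ suc m = q * (q ^ℚ m)

fromℕ : ℕ → ℚ
fromℕ m = + m / 1

boxVecs : (k : ℕ) → ℕ → List (Vec ℕ k)
boxVecs zero    n = [] ∷ []
boxVecs (suc k) n = concatMap (λ a → map (a ∷_) (boxVecs k n)) (upTo (suc n))

all≥3 : ∀ {k} → Vec ℕ k → Bool
all≥3 []       = true
all≥3 (a ∷ as) = (3 ≤ᵇ a) ∧ all≥3 as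

valid : ∀ {k} → ℕ → Vec ℕ k → Bool
valid n v = (Vec.sum v ≡ᵇ n) ∧ all≥3 v

-- all ordered k-tuples of integers with sum n and entries ≥ 3
-- (such entries are automatically ≤ n, so enumerating {0..n}^k is exhaustive)
tuples : (k n : ℕ) → List (Vec ℕ k)
tuples k n = filter (λ v → T? (valid n v)) (boxVecs k n)

prodRecip : ∀ {k} → Vec ℕ k → ℚ
prodRecip []       = 1ℚ
prodRecip (a ∷ as) = recip a * prodRecip as

sumℚ : List ℚ → ℚ
sumℚ = foldr _+_ 0ℚ

compSum : (k n : ℕ) → ℚ
compSum k n = sumℚ (map prodRecip (tuples k n))

expPartial : ℚ → ℕ → ℚ
expPartial r zero    = 0ℚ
expPartial r (suc N) = expPartial r N + (r ^ℚ N) * recip (N !)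

-- "log n < r" for a rational r ≥ 0:  e^r > n, i.e. some partial sum of the
-- exponential series exceeds n (partial sums increase to e^r when r ≥ 0)
LogLt : ℕ → ℚ → Set
LogLt n r = ∃ λ N → fromℕ n < expPartial r N

-- "x ≤ c · (log n)^m"  (for c ≥ 0 and n ≥ 2, so log n > 0), expressed through
-- the Dedekind upper cut of the real number log n:
-- for every rational r ≥ 0 with log n < r we have x ≤ c · r^m.
LeScaledLogPow : ℚ → ℚ → ℕ → ℕ → Set
LeScaledLogPow x c n m = ∀ (r : ℚ) → 0ℚ ≤ r → LogLt n r → x ≤ c * (r ^ℚ m)

-- Write S k m for the sum over k-tuples of parts ≥ 3 with total m, and H m = Σ_{3 ≤ i < m} 1/i.
-- Multiplying a term by m = a₁ + … + a_{k+1} and cancelling each aᵢ against its 1/aᵢ gives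
--   m · S (k+1) m = (k+1) · Σ_{3 ≤ b ≤ m} S k (m − b)
-- (formally by induction on k, splitting m = a₁ + (m − a₁)).  Induction on k then yields
--   S (k+1) m ≤ (k+1)/m · H m ^ k :
-- the sum on the right is at most Σ_{i<m} (k/i) · H i ^ (k−1) ≤ H m ^ k, because Bernoulli's
-- inequality (x + d)^k ≥ x^k + k d x^(k−1) makes its terms telescope.  Finally H n ≤ log n:
-- every partial sum of the exponential series at H m is at most m − 1, by induction on m from
-- e^(x+d) − e^x ≤ d e^(x+d) with d = 1/m.

module Submission where

open import Defs
open import Algebra.Bundles using (CommutativeMonoid)
open import Data.Bool using (Bool; true; false; T; _∧_)
open import Data.Bool.Properties using (∧-comm; ∧-commutativeMonoid; T-∧)
open import Algebra.Properties.CommutativeSemigroup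
  (CommutativeMonoid.commutativeSemigroup ∧-commutativeMonoid) using (interchange)
import Data.Integer as ℤ
open import Data.List as List using (List; []; _∷_; _++_)
open import Data.List.Properties using (map-cong; map-∘)
open import Data.Nat as ℕ using (ℕ; zero; suc; _∸_; _≤ᵇ_; _≡ᵇ_; _!; z≤n; s≤s)
import Data.Nat.Properties as ℕP
open import Data.Nat.Coprimality using (1-coprimeTo) renaming (sym to coprime-sym)
open import Data.Product using (_×_; _,_; uncurry)
open import Data.Rational as ℚ using (ℚ; 0ℚ; 1ℚ; mkℚ; _+_; _*_; _≤_; _<_)
import Data.Rational.Properties as ℚP
open import Data.Rational.Solver using (module +-*-Solver)
open +-*-Solver
open import Data.Vec as Vec using (Vec; []; _∷_)
open import Function using (_∘_)
open import Function.Bundles using (Equivalence)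
open import Relation.Binary.PropositionalEquality
open import Relation.Nullary using (¬_; yes; no; contradiction)
open import Relation.Nullary.Decidable using (T?)

private
  fromℕ-mkℚ : ∀ m → fromℕ m ≡ mkℚ (ℤ.+ m) 0 (coprime-sym (1-coprimeTo m))
  fromℕ-mkℚ m = ℚP.normalize-coprime (coprime-sym (1-coprimeTo m))

  recip-mkℚ : ∀ m → recip (suc m) ≡ mkℚ (ℤ.+ 1) m (1-coprimeTo (suc m))
  recip-mkℚ m = ℚP.normalize-coprime (1-coprimeTo (suc m))

fromℕ-suc : ∀ m → fromℕ (suc m) ≡ 1ℚ + fromℕ m
fromℕ-suc zero    = refl
fromℕ-suc (suc m) rewrite fromℕ-mkℚ (suc m) | ℕP.*-identityʳ m = refl

fromℕ-+ : ∀ a b → fromℕ (a ℕ.+ b) ≡ fromℕ a + fromℕ b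
fromℕ-+ zero    b = sym (ℚP.+-identityˡ (fromℕ b))
fromℕ-+ (suc a) b rewrite fromℕ-suc (a ℕ.+ b) | fromℕ-suc a | fromℕ-+ a b =
  sym (ℚP.+-assoc 1ℚ (fromℕ a) (fromℕ b))

fromℕ-* : ∀ a b → fromℕ (a ℕ.* b) ≡ fromℕ a * fromℕ b
fromℕ-* zero    b = sym (ℚP.*-zeroˡ (fromℕ b))
fromℕ-* (suc a) b rewrite fromℕ-+ b (a ℕ.* b) | fromℕ-suc a | fromℕ-* a b =
  solve 2 (λ x y → y :+ x :* y := (con 1ℚ :+ x) :* y) refl (fromℕ a) (fromℕ b)

fromℕ*recip≡1 : ∀ m → fromℕ (suc m) * recip (suc m) ≡ 1ℚ
fromℕ*recip≡1 m rewrite fromℕ-mkℚ (suc m) | recip-mkℚ m =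
  ℚP.*-inverseʳ (mkℚ (ℤ.+ suc m) 0 (coprime-sym (1-coprimeTo (suc m))))

recip-*-fromℕ : ∀ a b → recip (suc a ℕ.* suc b) * fromℕ (suc a) ≡ recip (suc b)
recip-*-fromℕ a b = begin
    r * x                    ≡⟨ sym (ℚP.*-identityʳ (r * x)) ⟩
    r * x * 1ℚ               ≡⟨ cong (r * x *_) (sym (fromℕ*recip≡1 b)) ⟩
    r * x * (y * v)          ≡⟨ solve 4 (λ r x y v → r :* x :* (y :* v) := x :* y :* r :* v)
                                        refl r x y v ⟩
    x * y * r * v            ≡⟨ cong (λ z → z * r * v) (sym (fromℕ-* (suc a) (suc b))) ⟩
    fromℕ (suc a ℕ.* suc b) * r * v ≡⟨ cong (_* v) (fromℕ*recip≡1 (b ℕ.+ a ℕ.* suc b)) ⟩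
    1ℚ * v                   ≡⟨ ℚP.*-identityˡ v ⟩
    v                        ∎
  where
  open ≡-Reasoning
  r = recip (suc a ℕ.* suc b)
  x = fromℕ (suc a)
  y = fromℕ (suc b)
  v = recip (suc b)

fromℕ-nonNeg : ∀ m → 0ℚ ≤ fromℕ m
fromℕ-nonNeg m = ℚP.nonNegative⁻¹ (fromℕ m) {{ℚP.normalize-nonNeg m 1}}

fromℕ-pos : ∀ m → 0ℚ < fromℕ (suc m)
fromℕ-pos m = ℚP.positive⁻¹ (fromℕ (suc m)) {{ℚP.normalize-pos (suc m) 1}}

recip-nonNeg : ∀ m → 0ℚ ≤ recip m
recip-nonNeg zero    = ℚP.≤-refl
recip-nonNeg (suc m) = ℚP.nonNegative⁻¹ (recip (suc m)) {{ℚP.normalize-nonNeg 1 (suc m)}}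

*-monoˡ-≤-≥0 : ∀ {p q} r → 0ℚ ≤ r → p ≤ q → r * p ≤ r * q
*-monoˡ-≤-≥0 r 0≤r = ℚP.*-monoˡ-≤-nonNeg r {{ℚ.nonNegative 0≤r}}

*-monoʳ-≤-≥0 : ∀ {p q} r → 0ℚ ≤ r → p ≤ q → p * r ≤ q * r
*-monoʳ-≤-≥0 r 0≤r = ℚP.*-monoʳ-≤-nonNeg r {{ℚ.nonNegative 0≤r}}

*-nonNeg : ∀ {p q} → 0ℚ ≤ p → 0ℚ ≤ q → 0ℚ ≤ p * q
*-nonNeg {p} 0≤p 0≤q = ℚP.≤-trans (ℚP.≤-reflexive (sym (ℚP.*-zeroʳ p))) (*-monoˡ-≤-≥0 p 0≤p 0≤q)

+-nonNeg : ∀ {p q} → 0ℚ ≤ p → 0ℚ ≤ q → 0ℚ ≤ p + q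
+-nonNeg = ℚP.+-mono-≤

≤-+-nonNeg : ∀ {x y z} → 0ℚ ≤ y → z ≤ x → z ≤ x + y
≤-+-nonNeg {x} 0≤y z≤x = ℚP.≤-trans z≤x
  (ℚP.≤-trans (ℚP.≤-reflexive (sym (ℚP.+-identityʳ x))) (ℚP.+-monoʳ-≤ x 0≤y))

fromℕ*≤⇒≤recip* : ∀ m {x y} → fromℕ (suc m) * x ≤ y → x ≤ recip (suc m) * y
fromℕ*≤⇒≤recip* m {x} {y} mx≤y = begin
  x                           ≡⟨ sym (ℚP.*-identityˡ x) ⟩
  1ℚ * x                      ≡⟨ cong (_* x) (sym (trans (ℚP.*-comm r _) (fromℕ*recip≡1 m))) ⟩
  r * fromℕ (suc m) * x       ≡⟨ ℚP.*-assoc r _ x ⟩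
  r * (fromℕ (suc m) * x)     ≤⟨ *-monoˡ-≤-≥0 r (recip-nonNeg (suc m)) mx≤y ⟩
  r * y                       ∎
  where
  open ℚP.≤-Reasoning
  r = recip (suc m)

^-nonNeg : ∀ {b} j → 0ℚ ≤ b → 0ℚ ≤ b ^ℚ j
^-nonNeg zero    0≤b = ℚP.nonNegative⁻¹ 1ℚ
^-nonNeg (suc j) 0≤b = *-nonNeg 0≤b (^-nonNeg j 0≤b)

^-monoˡ-≤ : ∀ {a b} j → 0ℚ ≤ b → b ≤ a → b ^ℚ j ≤ a ^ℚ j
^-monoˡ-≤ zero    0≤b b≤a = ℚP.≤-refl
^-monoˡ-≤ {a} {b} (suc j) 0≤b b≤a = ℚP.≤-trans
  (*-monoʳ-≤-≥0 (b ^ℚ j) (^-nonNeg j 0≤b) b≤a)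
  (*-monoˡ-≤-≥0 a (ℚP.≤-trans 0≤b b≤a) (^-monoˡ-≤ j 0≤b b≤a))

fromℕ*recip*-split : ∀ a m x → 1 ℕ.≤ a → a ℕ.≤ m →
  fromℕ m * (recip a * x) ≡ x + recip a * (fromℕ (m ∸ a) * x)
fromℕ*recip*-split a@(suc a-1) m x _ a≤m = begin
    fromℕ m * (r * x)
  ≡⟨ cong (λ i → fromℕ i * (r * x)) (sym (ℕP.m+[n∸m]≡n a≤m)) ⟩
    fromℕ (a ℕ.+ (m ∸ a)) * (r * x)
  ≡⟨ cong (_* (r * x)) (fromℕ-+ a (m ∸ a)) ⟩
    (fromℕ a + fromℕ (m ∸ a)) * (r * x)
  ≡⟨ solve 4 (λ y d r x → (y :+ d) :* (r :* x) := (y :* r) :* x :+ r :* (d :* x)) refl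
       (fromℕ a) (fromℕ (m ∸ a)) r x ⟩
    fromℕ a * r * x + r * (fromℕ (m ∸ a) * x)
  ≡⟨ cong (λ y → y * x + r * (fromℕ (m ∸ a) * x)) (fromℕ*recip≡1 a-1) ⟩
    1ℚ * x + r * (fromℕ (m ∸ a) * x)
  ≡⟨ cong (_+ r * (fromℕ (m ∸ a) * x)) (ℚP.*-identityˡ x) ⟩
    x + r * (fromℕ (m ∸ a) * x)
  ∎
  where
  open ≡-Reasoning
  r = recip a

^-suc-+-≥ : ∀ j b d → 0ℚ ≤ b → 0ℚ ≤ d →
  b ^ℚ suc j + fromℕ (suc j) * (d * b ^ℚ j) ≤ (b + d) ^ℚ suc j
^-suc-+-≥ zero    b d _ _ = ℚP.≤-reflexive
  (solve 2 (λ b d → b :* con 1ℚ :+ con 1ℚ :* (d :* con 1ℚ) := (b :+ d) :* con 1ℚ) refl b d)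
^-suc-+-≥ (suc j) b d 0≤b 0≤d = begin
    b * (b * p) + fromℕ (2 ℕ.+ j) * (d * (b * p))
  ≡⟨ cong (λ z → b * (b * p) + z * (d * (b * p))) (fromℕ-suc (suc j)) ⟩
    b * (b * p) + (1ℚ + c) * (d * (b * p))
  ≤⟨ ≤-+-nonNeg (*-nonNeg (fromℕ-nonNeg (suc j)) (*-nonNeg 0≤d (*-nonNeg 0≤d (^-nonNeg j 0≤b))))
                 ℚP.≤-refl ⟩
    b * (b * p) + (1ℚ + c) * (d * (b * p)) + c * (d * (d * p))
  ≡⟨ solve 4 (λ b d c p → b :* (b :* p) :+ (con 1ℚ :+ c) :* (d :* (b :* p)) :+ c :* (d :* (d :* p))
                        := (b :+ d) :* (b :* p :+ c :* (d :* p))) refl b d c p ⟩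
    (b + d) * (b * p + c * (d * p))
  ≤⟨ *-monoˡ-≤-≥0 (b + d) (+-nonNeg 0≤b 0≤d) (^-suc-+-≥ j b d 0≤b 0≤d) ⟩
    (b + d) * (b + d) ^ℚ suc j
  ∎
  where
  open ℚP.≤-Reasoning
  p = b ^ℚ j
  c = fromℕ (suc j)

^-suc-+-≤ : ∀ j b d → 0ℚ ≤ b → 0ℚ ≤ d →
  (b + d) ^ℚ suc j ≤ b ^ℚ suc j + fromℕ (suc j) * (d * (b + d) ^ℚ j)
^-suc-+-≤ zero    b d _ _ = ℚP.≤-reflexive
  (solve 2 (λ b d → (b :+ d) :* con 1ℚ := b :* con 1ℚ :+ con 1ℚ :* (d :* con 1ℚ)) refl b d)
^-suc-+-≤ (suc j) b d 0≤b 0≤d = begin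
    s * (s * q)
  ≡⟨ solve 3 (λ b d Q → (b :+ d) :* Q := b :* Q :+ d :* Q) refl b d (s * q) ⟩
    b * (s * q) + d * (s * q)
  ≤⟨ ℚP.+-monoˡ-≤ (d * (s * q)) (*-monoˡ-≤-≥0 b 0≤b (^-suc-+-≤ j b d 0≤b 0≤d)) ⟩
    b * (b * p + c * (d * q)) + d * (s * q)
  ≡⟨ solve 6 (λ b d c q p Q → b :* (b :* p :+ c :* (d :* q)) :+ d :* Q
                           := b :* (b :* p) :+ c :* (d :* (b :* q)) :+ d :* Q) refl b d c q p (s * q) ⟩
    b * (b * p) + c * (d * (b * q)) + d * (s * q)
  ≤⟨ ℚP.+-monoˡ-≤ (d * (s * q)) (ℚP.+-monoʳ-≤ (b * (b * p))
       (*-monoˡ-≤-≥0 c (fromℕ-nonNeg (suc j)) (*-monoˡ-≤-≥0 d 0≤d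
         (*-monoʳ-≤-≥0 q (^-nonNeg j (+-nonNeg 0≤b 0≤d)) (≤-+-nonNeg 0≤d (ℚP.≤-refl {b})))))) ⟩
    b * (b * p) + c * (d * (s * q)) + d * (s * q)
  ≡⟨ solve 4 (λ x c d Q → x :+ c :* (d :* Q) :+ d :* Q := x :+ (con 1ℚ :+ c) :* (d :* Q))
       refl (b * (b * p)) c d (s * q) ⟩
    b * (b * p) + (1ℚ + c) * (d * (s * q))
  ≡⟨ cong (λ z → b * (b * p) + z * (d * (s * q))) (sym (fromℕ-suc (suc j))) ⟩
    b * (b * p) + fromℕ (2 ℕ.+ j) * (d * (s * q))
  ∎
  where
  open ℚP.≤-Reasoning
  s = b + d
  q = s ^ℚ j
  p = b ^ℚ j
  c = fromℕ (suc j)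

-- Finite sums

infix 5 ∑<
∑< : ℕ → (ℕ → ℚ) → ℚ
∑< zero    f = 0ℚ
∑< (suc N) f = f 0 + ∑< N (f ∘ suc)

syntax ∑< N (λ i → e) = ∑[ i < N ] e

∑-cong : ∀ {f g} N → (∀ i → f i ≡ g i) → ∑< N f ≡ ∑< N g
∑-cong zero    f≡g = refl
∑-cong (suc N) f≡g = cong₂ _+_ (f≡g 0) (∑-cong N (f≡g ∘ suc))

∑-zero : ∀ N → (∑[ i < N ] 0ℚ) ≡ 0ℚ
∑-zero zero    = refl
∑-zero (suc N) = trans (ℚP.+-identityˡ _) (∑-zero N)

∑-+ : ∀ N f g → (∑[ i < N ] (f i + g i)) ≡ ∑< N f + ∑< N g
∑-+ zero    f g = refl
∑-+ (suc N) f g rewrite ∑-+ N (f ∘ suc) (g ∘ suc) =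
  solve 4 (λ a b c d → (a :+ b) :+ (c :+ d) := (a :+ c) :+ (b :+ d)) refl
    (f 0) (g 0) (∑< N (f ∘ suc)) (∑< N (g ∘ suc))

∑-*ˡ : ∀ N c f → (∑[ i < N ] c * f i) ≡ c * ∑< N f
∑-*ˡ zero    c f = sym (ℚP.*-zeroʳ c)
∑-*ˡ (suc N) c f rewrite ∑-*ˡ N c (f ∘ suc) = sym (ℚP.*-distribˡ-+ c (f 0) _)

∑-mono : ∀ {f g} N → (∀ i → f i ≤ g i) → ∑< N f ≤ ∑< N g
∑-mono zero    f≤g = ℚP.≤-refl
∑-mono (suc N) f≤g = ℚP.+-mono-≤ (f≤g 0) (∑-mono N (f≤g ∘ suc))

∑-swap : ∀ (f : ℕ → ℕ → ℚ) N M → (∑[ a < N ] ∑[ b < M ] f a b) ≡ (∑[ b < M ] ∑[ a < N ] f a b)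
∑-swap f zero    M = sym (∑-zero M)
∑-swap f (suc N) M rewrite ∑-swap (f ∘ suc) N M = sym (∑-+ M (f 0) _)

∑-snoc : ∀ N f → ∑< (suc N) f ≡ ∑< N f + f N
∑-snoc zero    f = ℚP.+-comm (f 0) 0ℚ
∑-snoc (suc N) f rewrite ∑-snoc N (f ∘ suc) = sym (ℚP.+-assoc (f 0) _ _)

∑-reverse : ∀ N f → (∑[ i < N ] f (N ∸ suc i)) ≡ ∑< N f
∑-reverse zero    f = refl
∑-reverse (suc N) f rewrite ∑-reverse N f | ∑-snoc N f = ℚP.+-comm (f N) _

∑-telescope : ∀ (φ T : ℕ → ℚ) m → (∀ i → φ i + T i ≤ T (suc i)) → ∑< m φ + T 0 ≤ T m
∑-telescope φ T zero    step = ℚP.≤-reflexive (ℚP.+-identityˡ (T 0))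
∑-telescope φ T (suc m) step = begin
    φ 0 + ∑< m (φ ∘ suc) + T 0
  ≡⟨ solve 3 (λ a b c → (a :+ b) :+ c := b :+ (a :+ c)) refl (φ 0) (∑< m (φ ∘ suc)) (T 0) ⟩
    ∑< m (φ ∘ suc) + (φ 0 + T 0)
  ≤⟨ ℚP.+-monoʳ-≤ (∑< m (φ ∘ suc)) (step 0) ⟩
    ∑< m (φ ∘ suc) + T 1
  ≤⟨ ∑-telescope (φ ∘ suc) (T ∘ suc) m (step ∘ suc) ⟩
    T (suc m)
  ∎
  where open ℚP.≤-Reasoning

when : Bool → ℚ → ℚ
when true  x = x
when false _ = 0ℚ

when-true : ∀ {b x} → T b → when b x ≡ x
when-true {true} _ = refl

when-false : ∀ b {x} → ¬ T b → when b x ≡ 0ℚ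
when-false true  ¬b = contradiction _ ¬b
when-false false _  = refl

when-cong : ∀ b {x y} → (T b → x ≡ y) → when b x ≡ when b y
when-cong true  x≡y = x≡y _
when-cong false _   = refl

when-zero : ∀ b → when b 0ℚ ≡ 0ℚ
when-zero true  = refl
when-zero false = refl

when-∧ : ∀ b c x → when (b ∧ c) x ≡ when b (when c x)
when-∧ true  c x = refl
when-∧ false c x = refl

when-+ : ∀ b x y → when b (x + y) ≡ when b x + when b y
when-+ true  x y = refl
when-+ false x y = refl

when-*ˡ : ∀ b c x → when b (c * x) ≡ c * when b x
when-*ˡ true  c x = refl
when-*ˡ false c x = sym (ℚP.*-zeroʳ c)

when-*-when : ∀ b c d x → when b (c * when d x) ≡ when (b ∧ d) (c * x)
when-*-when true  c d x = sym (when-*ˡ d c x)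
when-*-when false c d x = refl

when-nonNeg : ∀ b {x} → 0ℚ ≤ x → 0ℚ ≤ when b x
when-nonNeg true  0≤x = 0≤x
when-nonNeg false _   = ℚP.≤-refl

when-mono : ∀ b {x y} → x ≤ y → when b x ≤ when b y
when-mono true  x≤y = x≤y
when-mono false _   = ℚP.≤-refl

when-∧-≤ : ∀ b c {x y} → 0ℚ ≤ y → x ≤ y → when (b ∧ c) x ≤ when c y
when-∧-≤ true  c _   x≤y = when-mono c x≤y
when-∧-≤ false c 0≤y _   = when-nonNeg c 0≤y

∑-when : ∀ N b f → when b (∑< N f) ≡ (∑[ i < N ] when b (f i))
∑-when N true  f = refl
∑-when N false f = sym (∑-zero N)

∑-truncate : ∀ n N f → n ℕ.≤ N → (∑[ i < N ] when (suc i ≤ᵇ n) (f i)) ≡ ∑< n f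
∑-truncate zero    N       f _         = ∑-zero N
∑-truncate (suc n) (suc N) f (s≤s n≤N) = cong (f 0 +_) (∑-truncate n N (f ∘ suc) n≤N)

∑ₗ : {A : Set} → List A → (A → ℚ) → ℚ
∑ₗ xs f = sumℚ (List.map f xs)

module _ {A : Set} where

  ∑ₗ-cong : ∀ (xs : List A) {f g} → (∀ x → f x ≡ g x) → ∑ₗ xs f ≡ ∑ₗ xs g
  ∑ₗ-cong xs f≡g = cong sumℚ (map-cong f≡g xs)

  ∑ₗ-*ˡ : ∀ (xs : List A) c f → ∑ₗ xs (λ x → c * f x) ≡ c * ∑ₗ xs f
  ∑ₗ-*ˡ []       c f = sym (ℚP.*-zeroʳ c)
  ∑ₗ-*ˡ (x ∷ xs) c f = trans (cong (c * f x +_) (∑ₗ-*ˡ xs c f)) (sym (ℚP.*-distribˡ-+ c (f x) _))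

  ∑ₗ-when : ∀ (xs : List A) b f → ∑ₗ xs (λ x → when b (f x)) ≡ when b (∑ₗ xs f)
  ∑ₗ-when []       b f = sym (when-zero b)
  ∑ₗ-when (x ∷ xs) b f = trans (cong (when b (f x) +_) (∑ₗ-when xs b f)) (sym (when-+ b (f x) _))

  ∑ₗ-++ : ∀ (xs ys : List A) f → ∑ₗ (xs ++ ys) f ≡ ∑ₗ xs f + ∑ₗ ys f
  ∑ₗ-++ []       ys f = sym (ℚP.+-identityˡ (∑ₗ ys f))
  ∑ₗ-++ (x ∷ xs) ys f = trans (cong (f x +_) (∑ₗ-++ xs ys f)) (sym (ℚP.+-assoc (f x) _ _))

  ∑ₗ-filter : ∀ (p : A → Bool) xs f →
    ∑ₗ (List.filter (λ x → T? (p x)) xs) f ≡ ∑ₗ xs (λ x → when (p x) (f x))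
  ∑ₗ-filter p []       f = refl
  ∑ₗ-filter p (x ∷ xs) f with p x
  ... | true  = cong (f x +_) (∑ₗ-filter p xs f)
  ... | false = trans (∑ₗ-filter p xs f) (sym (ℚP.+-identityˡ _))

  ∑ₗ-applyUpTo : ∀ (h : ℕ → A) N f → ∑ₗ (List.applyUpTo h N) f ≡ (∑[ i < N ] f (h i))
  ∑ₗ-applyUpTo h zero    f = refl
  ∑ₗ-applyUpTo h (suc N) f = cong (f (h 0) +_) (∑ₗ-applyUpTo (h ∘ suc) N f)

∑ₗ-concatMap : ∀ {A C : Set} (h : A → List C) xs f →
  ∑ₗ (List.concatMap h xs) f ≡ ∑ₗ xs (λ x → ∑ₗ (h x) f)
∑ₗ-concatMap h []       f = refl
∑ₗ-concatMap h (x ∷ xs) f =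
  trans (∑ₗ-++ (h x) (List.concatMap h xs) f) (cong (∑ₗ (h x) f +_) (∑ₗ-concatMap h xs f))

∑ₗ-boxVecs-suc : ∀ k B (f : Vec ℕ (suc k) → ℚ) →
  ∑ₗ (boxVecs (suc k) B) f ≡ (∑[ a < suc B ] ∑ₗ (boxVecs k B) (f ∘ (a ∷_)))
∑ₗ-boxVecs-suc k B f = begin
    ∑ₗ (List.concatMap (λ a → List.map (a ∷_) (boxVecs k B)) (List.upTo (suc B))) f
  ≡⟨ ∑ₗ-concatMap (λ a → List.map (a ∷_) (boxVecs k B)) (List.upTo (suc B)) f ⟩
    ∑ₗ (List.upTo (suc B)) (λ a → ∑ₗ (List.map (a ∷_) (boxVecs k B)) f)
  ≡⟨ ∑ₗ-applyUpTo (λ a → a) (suc B) (λ a → ∑ₗ (List.map (a ∷_) (boxVecs k B)) f) ⟩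
    (∑[ a < suc B ] ∑ₗ (List.map (a ∷_) (boxVecs k B)) f)
  ≡⟨ ∑-cong (suc B) (λ a → cong sumℚ (sym (map-∘ {g = f} {f = a ∷_} (boxVecs k B)))) ⟩
    (∑[ a < suc B ] ∑ₗ (boxVecs k B) (f ∘ (a ∷_)))
  ∎
  where open ≡-Reasoning

-- Compositions into parts ≥ 3

suc-≤ᵇ-suc : ∀ a m → (suc a ≤ᵇ suc m) ≡ (a ≤ᵇ m)
suc-≤ᵇ-suc zero    m = refl
suc-≤ᵇ-suc (suc a) m = refl

≤ᵇ-+ : ∀ a b m → (a ≤ᵇ m) ∧ (b ≤ᵇ m ∸ a) ≡ (a ℕ.+ b ≤ᵇ m)
≤ᵇ-+ zero    b m       = refl
≤ᵇ-+ (suc a) b zero    = refl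
≤ᵇ-+ (suc a) b (suc m) rewrite suc-≤ᵇ-suc a m | suc-≤ᵇ-suc (a ℕ.+ b) m = ≤ᵇ-+ a b m

≡ᵇ-+ : ∀ a s m → (a ℕ.+ s ≡ᵇ m) ≡ (a ≤ᵇ m) ∧ (s ≡ᵇ m ∸ a)
≡ᵇ-+ zero    s m       = refl
≡ᵇ-+ (suc a) s zero    = refl
≡ᵇ-+ (suc a) s (suc m) rewrite suc-≤ᵇ-suc a m = ≡ᵇ-+ a s m

∸-∸-comm : ∀ m a b → m ∸ a ∸ b ≡ m ∸ b ∸ a
∸-∸-comm m a b = begin
  m ∸ a ∸ b       ≡⟨ ℕP.∸-+-assoc m a b ⟩
  m ∸ (a ℕ.+ b)   ≡⟨ cong (m ∸_) (ℕP.+-comm a b) ⟩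
  m ∸ (b ℕ.+ a)   ≡⟨ ℕP.∸-+-assoc m b a ⟨
  m ∸ b ∸ a       ∎
  where open ≡-Reasoning

admissible : ℕ → ℕ → Bool
admissible a m = (3 ≤ᵇ a) ∧ (a ≤ᵇ m)

admissible⇒ : ∀ {a m} → T (admissible a m) → 3 ℕ.≤ a × a ℕ.≤ m
admissible⇒ {a} {m} adm with Equivalence.to T-∧ adm
... | 3≤a , a≤m = ℕP.≤ᵇ⇒≤ 3 a 3≤a , ℕP.≤ᵇ⇒≤ a m a≤m

admissible-swap : ∀ a b m → admissible a m ∧ admissible b (m ∸ a) ≡ admissible b m ∧ admissible a (m ∸ b)
admissible-swap a b m = begin
    ((3 ≤ᵇ a) ∧ (a ≤ᵇ m)) ∧ ((3 ≤ᵇ b) ∧ (b ≤ᵇ m ∸ a))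
  ≡⟨ interchange (3 ≤ᵇ a) _ _ _ ⟩
    ((3 ≤ᵇ a) ∧ (3 ≤ᵇ b)) ∧ ((a ≤ᵇ m) ∧ (b ≤ᵇ m ∸ a))
  ≡⟨ cong₂ _∧_ (∧-comm (3 ≤ᵇ a) _) a+b≤m-sym ⟩
    ((3 ≤ᵇ b) ∧ (3 ≤ᵇ a)) ∧ ((b ≤ᵇ m) ∧ (a ≤ᵇ m ∸ b))
  ≡⟨ interchange (3 ≤ᵇ b) _ _ _ ⟩
    ((3 ≤ᵇ b) ∧ (b ≤ᵇ m)) ∧ ((3 ≤ᵇ a) ∧ (a ≤ᵇ m ∸ b))
  ∎
  where
  open ≡-Reasoning
  a+b≤m-sym : (a ≤ᵇ m) ∧ (b ≤ᵇ m ∸ a) ≡ (b ≤ᵇ m) ∧ (a ≤ᵇ m ∸ b)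
  a+b≤m-sym = begin
    (a ≤ᵇ m) ∧ (b ≤ᵇ m ∸ a)  ≡⟨ ≤ᵇ-+ a b m ⟩
    (a ℕ.+ b ≤ᵇ m)           ≡⟨ cong (_≤ᵇ m) (ℕP.+-comm a b) ⟩
    (b ℕ.+ a ≤ᵇ m)           ≡⟨ ≤ᵇ-+ b a m ⟨
    (b ≤ᵇ m) ∧ (a ≤ᵇ m ∸ b)  ∎

valid-∷ : ∀ a m {k} (v : Vec ℕ k) → valid m (a ∷ v) ≡ admissible a m ∧ valid (m ∸ a) v
valid-∷ a m v = begin
    (a ℕ.+ Vec.sum v ≡ᵇ m) ∧ ((3 ≤ᵇ a) ∧ all≥3 v)
  ≡⟨ cong (_∧ _) (≡ᵇ-+ a (Vec.sum v) m) ⟩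
    ((a ≤ᵇ m) ∧ (Vec.sum v ≡ᵇ m ∸ a)) ∧ ((3 ≤ᵇ a) ∧ all≥3 v)
  ≡⟨ interchange (a ≤ᵇ m) _ _ _ ⟩
    ((a ≤ᵇ m) ∧ (3 ≤ᵇ a)) ∧ valid (m ∸ a) v
  ≡⟨ cong (_∧ valid (m ∸ a) v) (∧-comm (a ≤ᵇ m) (3 ≤ᵇ a)) ⟩
    admissible a m ∧ valid (m ∸ a) v
  ∎
  where open ≡-Reasoning

fromℕ*when-admissible : ∀ a m x → fromℕ m * when (admissible a m) (recip a * x)
  ≡ when (admissible a m) x + when (admissible a m) (recip a * (fromℕ (m ∸ a) * x))
fromℕ*when-admissible a m x = begin
    fromℕ m * when adm (recip a * x)
  ≡⟨ when-*ˡ adm (fromℕ m) _ ⟨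
    when adm (fromℕ m * (recip a * x))
  ≡⟨ when-cong adm split ⟩
    when adm (x + recip a * (fromℕ (m ∸ a) * x))
  ≡⟨ when-+ adm _ _ ⟩
    when adm x + when adm (recip a * (fromℕ (m ∸ a) * x))
  ∎
  where
  open ≡-Reasoning
  adm = admissible a m
  split : T adm → fromℕ m * (recip a * x) ≡ x + recip a * (fromℕ (m ∸ a) * x)
  split t with admissible⇒ t
  ... | 3≤a , a≤m = fromℕ*recip*-split a m x (ℕP.≤-trans (s≤s z≤n) 3≤a) a≤m

-- The harmonic bound

H : ℕ → ℚ
H zero    = 0ℚ
H (suc m) = H m + when (3 ≤ᵇ m) (recip m)

H-nonNeg : ∀ m → 0ℚ ≤ H m
H-nonNeg zero    = ℚP.≤-refl
H-nonNeg (suc m) = +-nonNeg (H-nonNeg m) (when-nonNeg (3 ≤ᵇ m) (recip-nonNeg m))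

Φ : ℕ → ℕ → ℚ
Φ j m = when (3 ≤ᵇ m) (fromℕ (suc j) * (recip m * H m ^ℚ j))

Φ-nonNeg : ∀ j m → 0ℚ ≤ Φ j m
Φ-nonNeg j m = when-nonNeg (3 ≤ᵇ m)
  (*-nonNeg (fromℕ-nonNeg (suc j)) (*-nonNeg (recip-nonNeg m) (^-nonNeg j (H-nonNeg m))))

Φ+H^≤H^ : ∀ j i → Φ j i + H i ^ℚ suc j ≤ H (suc i) ^ℚ suc j
Φ+H^≤H^ j i with 3 ≤ᵇ i
... | false = ℚP.≤-reflexive
  (trans (ℚP.+-identityˡ _) (cong (_^ℚ suc j) (sym (ℚP.+-identityʳ (H i)))))
... | true  = ℚP.≤-trans (ℚP.≤-reflexive (ℚP.+-comm _ (H i ^ℚ suc j)))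
  (^-suc-+-≥ j (H i) (recip i) (H-nonNeg i) (recip-nonNeg i))

∑Φ≤H^ : ∀ j m → ∑< m (Φ j) ≤ H m ^ℚ suc j
∑Φ≤H^ j m = begin
  ∑< m (Φ j)                  ≡⟨ ℚP.+-identityʳ (∑< m (Φ j)) ⟨
  ∑< m (Φ j) + 0ℚ             ≡⟨ cong (∑< m (Φ j) +_) (ℚP.*-zeroˡ (0ℚ ^ℚ j)) ⟨
  ∑< m (Φ j) + H 0 ^ℚ suc j   ≤⟨ ∑-telescope (Φ j) (λ i → H i ^ℚ suc j) m (Φ+H^≤H^ j) ⟩
  H m ^ℚ suc j                ∎
  where open ℚP.≤-Reasoning

-- Partial sums of the exponential series

expPartial-≤-suc : ∀ {x} N → 0ℚ ≤ x → expPartial x N ≤ expPartial x (suc N)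
expPartial-≤-suc {x} N 0≤x =
  ≤-+-nonNeg (*-nonNeg (^-nonNeg N 0≤x) (recip-nonNeg (N !))) (ℚP.≤-refl {expPartial x N})

expPartial-mono : ∀ {a b} N → 0ℚ ≤ b → b ≤ a → expPartial b N ≤ expPartial a N
expPartial-mono zero    _   _   = ℚP.≤-refl
expPartial-mono (suc N) 0≤b b≤a = ℚP.+-mono-≤ (expPartial-mono N 0≤b b≤a)
  (*-monoʳ-≤-≥0 (recip (N !)) (recip-nonNeg (N !)) (^-monoˡ-≤ N 0≤b b≤a))

expPartial-0 : ∀ N → expPartial 0ℚ (suc N) ≡ 1ℚ
expPartial-0 zero    = refl
expPartial-0 (suc N) rewrite expPartial-0 N = begin
  1ℚ + 0ℚ * 0ℚ ^ℚ N * recip (suc N !)  ≡⟨ cong (λ z → 1ℚ + z * recip (suc N !)) (ℚP.*-zeroˡ (0ℚ ^ℚ N)) ⟩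
  1ℚ + 0ℚ * recip (suc N !)            ≡⟨ cong (1ℚ +_) (ℚP.*-zeroˡ (recip (suc N !))) ⟩
  1ℚ + 0ℚ                              ≡⟨ ℚP.+-identityʳ 1ℚ ⟩
  1ℚ                                   ∎
  where open ≡-Reasoning

recip-!-suc : ∀ N → recip (suc N ℕ.* N !) * fromℕ (suc N) ≡ recip (N !)
recip-!-suc N with N ! | ℕP.1≤n! N
... | suc p | _ = recip-*-fromℕ N p

expPartial-+-≤-suc : ∀ N b d → 0ℚ ≤ b → 0ℚ ≤ d →
  expPartial (b + d) (suc N) ≤ expPartial b (suc N) + d * expPartial (b + d) N
expPartial-+-≤-suc zero    b d _   _   = ℚP.≤-reflexive
  (sym (trans (cong (expPartial b 1 +_) (ℚP.*-zeroʳ d)) (ℚP.+-identityʳ _)))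
expPartial-+-≤-suc (suc N) b d 0≤b 0≤d = begin
    expPartial s (suc N) + s ^ℚ suc N * ρ
  ≤⟨ ℚP.+-mono-≤ (expPartial-+-≤-suc N b d 0≤b 0≤d)
                 (*-monoʳ-≤-≥0 ρ (recip-nonNeg (suc N !)) (^-suc-+-≤ N b d 0≤b 0≤d)) ⟩
    (expPartial b (suc N) + d * expPartial s N) + (b ^ℚ suc N + c * (d * s ^ℚ N)) * ρ
  ≡⟨ solve 7 (λ X Y d bN c sN ρ → (X :+ d :* Y) :+ (bN :+ c :* (d :* sN)) :* ρ
                                := (X :+ bN :* ρ) :+ d :* (Y :+ sN :* (ρ :* c)))
       refl (expPartial b (suc N)) (expPartial s N) d (b ^ℚ suc N) c (s ^ℚ N) ρ ⟩
    (expPartial b (suc N) + b ^ℚ suc N * ρ) + d * (expPartial s N + s ^ℚ N * (ρ * c))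
  ≡⟨ cong (λ z → (expPartial b (suc N) + b ^ℚ suc N * ρ) + d * (expPartial s N + s ^ℚ N * z))
          (recip-!-suc N) ⟩
    expPartial b (2 ℕ.+ N) + d * expPartial s (suc N)
  ∎
  where
  open ℚP.≤-Reasoning
  s = b + d
  ρ = recip (suc N !)
  c = fromℕ (suc N)

expPartial-+-≤ : ∀ N b d → 0ℚ ≤ b → 0ℚ ≤ d →
  expPartial (b + d) N ≤ expPartial b N + d * expPartial (b + d) N
expPartial-+-≤ zero    b d _   _   = ℚP.≤-reflexive
  (sym (trans (cong (0ℚ +_) (ℚP.*-zeroʳ d)) (ℚP.+-identityʳ 0ℚ)))
expPartial-+-≤ (suc N) b d 0≤b 0≤d = ℚP.≤-trans (expPartial-+-≤-suc N b d 0≤b 0≤d)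
  (ℚP.+-monoʳ-≤ (expPartial b (suc N))
    (*-monoˡ-≤-≥0 d 0≤d (expPartial-≤-suc N (+-nonNeg 0≤b 0≤d))))

≤+recip*⇒≤ : ∀ a {X} → X ≤ fromℕ (suc a) + recip (2 ℕ.+ a) * X → X ≤ fromℕ (2 ℕ.+ a)
≤+recip*⇒≤ a {X} X≤c+rX = ℚP.*-cancelˡ-≤-pos c {{ℚ.positive (fromℕ-pos a)}} cX≤cm
  where
  open ℚP.≤-Reasoning
  c = fromℕ (suc a)
  r = recip (2 ℕ.+ a)
  m≡1+c : fromℕ (2 ℕ.+ a) ≡ 1ℚ + c
  m≡1+c = fromℕ-suc (suc a)
  mX≤mc+X : (1ℚ + c) * X ≤ (1ℚ + c) * c + X
  mX≤mc+X = begin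
      (1ℚ + c) * X
    ≤⟨ *-monoˡ-≤-≥0 (1ℚ + c) (+-nonNeg (ℚP.nonNegative⁻¹ 1ℚ) (fromℕ-nonNeg (suc a))) X≤c+rX ⟩
      (1ℚ + c) * (c + r * X)
    ≡⟨ solve 4 (λ u c r X → u :* (c :+ r :* X) := u :* c :+ (u :* r) :* X) refl (1ℚ + c) c r X ⟩
      (1ℚ + c) * c + (1ℚ + c) * r * X
    ≡⟨ cong (λ z → (1ℚ + c) * c + z * r * X) m≡1+c ⟨
      (1ℚ + c) * c + fromℕ (2 ℕ.+ a) * r * X
    ≡⟨ cong (λ z → (1ℚ + c) * c + z * X) (fromℕ*recip≡1 (suc a)) ⟩
      (1ℚ + c) * c + 1ℚ * X
    ≡⟨ cong ((1ℚ + c) * c +_) (ℚP.*-identityˡ X) ⟩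
      (1ℚ + c) * c + X
    ∎
  cX≤cm : c * X ≤ c * fromℕ (2 ℕ.+ a)
  cX≤cm = begin
      c * X
    ≡⟨ solve 2 (λ c X → c :* X := (:- X) :+ (con 1ℚ :+ c) :* X) refl c X ⟩
      ℚ.- X + (1ℚ + c) * X
    ≤⟨ ℚP.+-monoʳ-≤ (ℚ.- X) mX≤mc+X ⟩
      ℚ.- X + ((1ℚ + c) * c + X)
    ≡⟨ solve 2 (λ c X → (:- X) :+ ((con 1ℚ :+ c) :* c :+ X) := c :* (con 1ℚ :+ c)) refl c X ⟩
      c * (1ℚ + c)
    ≡⟨ cong (c *_) m≡1+c ⟨
      c * fromℕ (2 ℕ.+ a)
    ∎

expPartial-H≤ : ∀ n N → expPartial (H (3 ℕ.+ n)) N ≤ fromℕ (2 ℕ.+ n)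
expPartial-H≤ zero    zero    = fromℕ-nonNeg 2
expPartial-H≤ zero    (suc N) rewrite expPartial-0 N =
  ≤-+-nonNeg (fromℕ-nonNeg 1) (ℚP.≤-refl {1ℚ})
expPartial-H≤ (suc n) N = ≤+recip*⇒≤ (suc n) (begin
    expPartial (h + r) N
  ≤⟨ expPartial-+-≤ N h r (H-nonNeg (3 ℕ.+ n)) (recip-nonNeg (3 ℕ.+ n)) ⟩
    expPartial h N + r * expPartial (h + r) N
  ≤⟨ ℚP.+-monoˡ-≤ (r * expPartial (h + r) N) (expPartial-H≤ n N) ⟩
    fromℕ (2 ℕ.+ n) + r * expPartial (h + r) N
  ∎)
  where
  open ℚP.≤-Reasoning
  h = H (3 ℕ.+ n)
  r = recip (3 ℕ.+ n)

H≤log : ∀ {m r} → 3 ℕ.≤ m → 0ℚ ≤ r → LogLt m r → H m ≤ r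
H≤log {m} {r} (s≤s (s≤s (s≤s {n = n} _))) 0≤r (N , m<eʳ) = ℚP.≮⇒≥ r≮H
  where
  open ℚP.≤-Reasoning
  r≮H : ¬ r < H m
  r≮H r<H = ℚP.<-irrefl refl (ℚP.<-≤-trans m<eʳ (begin
      expPartial r N
    ≤⟨ expPartial-mono N 0≤r (ℚP.<⇒≤ r<H) ⟩
      expPartial (H m) N
    ≤⟨ expPartial-H≤ n N ⟩
      fromℕ (2 ℕ.+ n)
    ≤⟨ ≤-+-nonNeg (ℚP.nonNegative⁻¹ 1ℚ) (ℚP.≤-refl {fromℕ (2 ℕ.+ n)}) ⟩
      fromℕ (2 ℕ.+ n) + 1ℚ
    ≡⟨ trans (ℚP.+-comm (fromℕ (2 ℕ.+ n)) 1ℚ) (sym (fromℕ-suc (2 ℕ.+ n))) ⟩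
      fromℕ m
    ∎))

-- Parts range over 0 … B so that sums over parts can be exchanged freely; `admissible a m`
-- keeps the parts with 3 ≤ a ≤ m.  For m ≤ B, S k m is the sum of the theorem, and A k m is
-- S (suc k) m with the factor 1/a of the first part omitted.
module Compositions (B : ℕ) where

  S : ℕ → ℕ → ℚ
  S zero    m = when (0 ≡ᵇ m) 1ℚ
  S (suc k) m = ∑[ a < suc B ] when (admissible a m) (recip a * S k (m ∸ a))

  A : ℕ → ℕ → ℚ
  A k m = ∑[ a < suc B ] when (admissible a m) (S k (m ∸ a))

  fromℕ*S₀≡0 : ∀ m → fromℕ m * S 0 m ≡ 0ℚ
  fromℕ*S₀≡0 zero    = refl
  fromℕ*S₀≡0 (suc m) = ℚP.*-zeroʳ (fromℕ (suc m))

  fromℕ*S-suc : ∀ k m → fromℕ m * S (suc k) m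
    ≡ A k m + (∑[ a < suc B ] when (admissible a m) (recip a * (fromℕ (m ∸ a) * S k (m ∸ a))))
  fromℕ*S-suc k m = begin
      fromℕ m * S (suc k) m
    ≡⟨ ∑-*ˡ (suc B) (fromℕ m) (λ a → when (admissible a m) (recip a * S k (m ∸ a))) ⟨
      (∑[ a < suc B ] fromℕ m * when (admissible a m) (recip a * S k (m ∸ a)))
    ≡⟨ ∑-cong (suc B) (λ a → fromℕ*when-admissible a m (S k (m ∸ a))) ⟩
      (∑[ a < suc B ] (when (admissible a m) (S k (m ∸ a))
                       + when (admissible a m) (recip a * (fromℕ (m ∸ a) * S k (m ∸ a)))))
    ≡⟨ ∑-+ (suc B) (λ a → when (admissible a m) (S k (m ∸ a)))
             (λ a → when (admissible a m) (recip a * (fromℕ (m ∸ a) * S k (m ∸ a)))) ⟩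
      A k m + (∑[ a < suc B ] when (admissible a m) (recip a * (fromℕ (m ∸ a) * S k (m ∸ a))))
    ∎
    where open ≡-Reasoning

  A-suc : ∀ k m → (∑[ a < suc B ] when (admissible a m) (recip a * A k (m ∸ a))) ≡ A (suc k) m
  A-suc k m = begin
      (∑[ a < suc B ] when (admissible a m) (recip a * A k (m ∸ a)))
    ≡⟨ ∑-cong (suc B) expand ⟩
      (∑[ a < suc B ] ∑[ b < suc B ] P a b)
    ≡⟨ ∑-swap P (suc B) (suc B) ⟩
      (∑[ b < suc B ] ∑[ a < suc B ] P a b)
    ≡⟨ ∑-cong (suc B) collapse ⟩
      A (suc k) m
    ∎
    where
    open ≡-Reasoning
    P : ℕ → ℕ → ℚ
    P a b = when (admissible a m ∧ admissible b (m ∸ a)) (recip a * S k (m ∸ a ∸ b))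

    expand : ∀ a → when (admissible a m) (recip a * A k (m ∸ a)) ≡ (∑[ b < suc B ] P a b)
    expand a = begin
        when adm-a (recip a * ∑< (suc B) second)
      ≡⟨ cong (when adm-a) (∑-*ˡ (suc B) (recip a) second) ⟨
        when adm-a (∑[ b < suc B ] recip a * second b)
      ≡⟨ ∑-when (suc B) adm-a (λ b → recip a * second b) ⟩
        (∑[ b < suc B ] when adm-a (recip a * second b))
      ≡⟨ ∑-cong (suc B) (λ b → when-*-when adm-a (recip a) (admissible b (m ∸ a)) (S k (m ∸ a ∸ b))) ⟩
        (∑[ b < suc B ] P a b)
      ∎
      where
      adm-a = admissible a m
      second : ℕ → ℚ
      second b = when (admissible b (m ∸ a)) (S k (m ∸ a ∸ b))

    collapse : ∀ b → (∑[ a < suc B ] P a b) ≡ when (admissible b m) (S (suc k) (m ∸ b))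
    collapse b = begin
        (∑[ a < suc B ] P a b)
      ≡⟨ ∑-cong (suc B) (λ a → cong₂ when (admissible-swap a b m)
                                          (cong (λ i → recip a * S k i) (∸-∸-comm m a b))) ⟩
        (∑[ a < suc B ] when (adm-b ∧ admissible a (m ∸ b)) (first a))
      ≡⟨ ∑-cong (suc B) (λ a → when-∧ adm-b (admissible a (m ∸ b)) (first a)) ⟩
        (∑[ a < suc B ] when adm-b (when (admissible a (m ∸ b)) (first a)))
      ≡⟨ ∑-when (suc B) adm-b (λ a → when (admissible a (m ∸ b)) (first a)) ⟨
        when adm-b (S (suc k) (m ∸ b))
      ∎
      where
      adm-b = admissible b m
      first : ℕ → ℚ
      first a = recip a * S k (m ∸ b ∸ a)

  S-suc-identity : ∀ k m → fromℕ m * S (suc k) m ≡ fromℕ (suc k) * A k m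
  S-suc-identity zero m = begin
      fromℕ m * S 1 m
    ≡⟨ fromℕ*S-suc 0 m ⟩
      A 0 m + (∑[ a < suc B ] when (admissible a m) (recip a * (fromℕ (m ∸ a) * S 0 (m ∸ a))))
    ≡⟨ cong (A 0 m +_) (trans (∑-cong (suc B) vanish) (∑-zero (suc B))) ⟩
      A 0 m + 0ℚ
    ≡⟨ ℚP.+-identityʳ (A 0 m) ⟩
      A 0 m
    ≡⟨ ℚP.*-identityˡ (A 0 m) ⟨
      1ℚ * A 0 m
    ∎
    where
    open ≡-Reasoning
    vanish : ∀ a → when (admissible a m) (recip a * (fromℕ (m ∸ a) * S 0 (m ∸ a))) ≡ 0ℚ
    vanish a = begin
      when (admissible a m) (recip a * (fromℕ (m ∸ a) * S 0 (m ∸ a)))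
        ≡⟨ cong (λ z → when (admissible a m) (recip a * z)) (fromℕ*S₀≡0 (m ∸ a)) ⟩
      when (admissible a m) (recip a * 0ℚ)
        ≡⟨ cong (when (admissible a m)) (ℚP.*-zeroʳ (recip a)) ⟩
      when (admissible a m) 0ℚ
        ≡⟨ when-zero (admissible a m) ⟩
      0ℚ ∎
  S-suc-identity (suc k) m = begin
      fromℕ m * S (2 ℕ.+ k) m
    ≡⟨ fromℕ*S-suc (suc k) m ⟩
      A (suc k) m
        + (∑[ a < suc B ] when (admissible a m) (recip a * (fromℕ (m ∸ a) * S (suc k) (m ∸ a))))
    ≡⟨ cong (A (suc k) m +_) (∑-cong (suc B) (λ a → cong (λ z → when (admissible a m) (recip a * z))
                                                       (S-suc-identity k (m ∸ a)))) ⟩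
      A (suc k) m + (∑[ a < suc B ] when (admissible a m) (recip a * (c * A k (m ∸ a))))
    ≡⟨ cong (A (suc k) m +_) (∑-cong (suc B) pull-c) ⟩
      A (suc k) m + (∑[ a < suc B ] c * when (admissible a m) (recip a * A k (m ∸ a)))
    ≡⟨ cong (A (suc k) m +_) (trans (∑-*ˡ (suc B) c (λ a → when (admissible a m) (recip a * A k (m ∸ a))))
                                    (cong (c *_) (A-suc k m))) ⟩
      A (suc k) m + c * A (suc k) m
    ≡⟨ solve 2 (λ x c → x :+ c :* x := (con 1ℚ :+ c) :* x) refl (A (suc k) m) c ⟩
      (1ℚ + c) * A (suc k) m
    ≡⟨ cong (_* A (suc k) m) (fromℕ-suc (suc k)) ⟨
      fromℕ (2 ℕ.+ k) * A (suc k) m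
    ∎
    where
    open ≡-Reasoning
    c = fromℕ (suc k)
    pull-c : ∀ a → when (admissible a m) (recip a * (c * A k (m ∸ a)))
                 ≡ c * when (admissible a m) (recip a * A k (m ∸ a))
    pull-c a = trans
      (cong (when (admissible a m))
        (solve 3 (λ r c x → r :* (c :* x) := c :* (r :* x)) refl (recip a) c (A k (m ∸ a))))
      (when-*ˡ (admissible a m) c _)

  S-suc-vanishes : ∀ k m → ¬ 3 ℕ.≤ m → S (suc k) m ≡ 0ℚ
  S-suc-vanishes k m m≱3 = trans (∑-cong (suc B) inadmissible) (∑-zero (suc B))
    where
    inadmissible : ∀ a → when (admissible a m) (recip a * S k (m ∸ a)) ≡ 0ℚ
    inadmissible a = when-false (admissible a m) (m≱3 ∘ uncurry ℕP.≤-trans ∘ admissible⇒ {a})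

  A≤∑ : ∀ k m (ψ : ℕ → ℚ) → m ℕ.≤ B → (∀ i → 0ℚ ≤ ψ i) → (∀ i → i ℕ.≤ B → S k i ≤ ψ i) →
        A k m ≤ ∑< m ψ
  A≤∑ k m ψ m≤B ψ≥0 S≤ψ = begin
      A k m
    ≡⟨ ℚP.+-identityˡ (∑[ a < B ] when (admissible (suc a) m) (S k (m ∸ suc a))) ⟩
      (∑[ a < B ] when (admissible (suc a) m) (S k (m ∸ suc a)))
    ≤⟨ ∑-mono B (λ a → when-∧-≤ (3 ≤ᵇ suc a) (suc a ≤ᵇ m) (ψ≥0 (m ∸ suc a))
                         (S≤ψ (m ∸ suc a) (ℕP.≤-trans (ℕP.m∸n≤m m (suc a)) m≤B))) ⟩
      (∑[ a < B ] when (suc a ≤ᵇ m) (ψ (m ∸ suc a)))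
    ≡⟨ ∑-truncate m B (λ a → ψ (m ∸ suc a)) m≤B ⟩
      (∑[ a < m ] ψ (m ∸ suc a))
    ≡⟨ ∑-reverse m ψ ⟩
      ∑< m ψ
    ∎
    where open ℚP.≤-Reasoning

  ∑S₀≡1 : ∀ m → ∑< (suc m) (S 0) ≡ 1ℚ
  ∑S₀≡1 m = trans (cong (1ℚ +_) (∑-zero m)) (ℚP.+-identityʳ 1ℚ)

  S₀-nonNeg : ∀ m → 0ℚ ≤ S 0 m
  S₀-nonNeg m = when-nonNeg (0 ≡ᵇ m) (ℚP.nonNegative⁻¹ 1ℚ)

  A≤H^ : ∀ j m → 1 ℕ.≤ m → m ℕ.≤ B → A j m ≤ H m ^ℚ j
  S-suc≤Φ : ∀ j m → m ℕ.≤ B → S (suc j) m ≤ Φ j m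

  A≤H^ zero    (suc m) _ m≤B = ℚP.≤-trans
    (A≤∑ 0 (suc m) (S 0) m≤B S₀-nonNeg (λ _ _ → ℚP.≤-refl))
    (ℚP.≤-reflexive (∑S₀≡1 m))
  A≤H^ (suc j) m       _ m≤B = ℚP.≤-trans
    (A≤∑ (suc j) m (Φ j) m≤B (Φ-nonNeg j) (λ i i≤B → S-suc≤Φ j i i≤B))
    (∑Φ≤H^ j m)

  S-suc≤Φ j m m≤B with 3 ℕ.≤? m
  ... | no m≱3 = ℚP.≤-reflexive
    (trans (S-suc-vanishes j m m≱3) (sym (when-false (3 ≤ᵇ m) (m≱3 ∘ ℕP.≤ᵇ⇒≤ 3 m))))
  ... | yes 3≤m@(s≤s {n = m-1} _) = begin
      S (suc j) m
    ≤⟨ fromℕ*≤⇒≤recip* m-1 (begin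
         fromℕ m * S (suc j) m      ≡⟨ S-suc-identity j m ⟩
         fromℕ (suc j) * A j m      ≤⟨ *-monoˡ-≤-≥0 (fromℕ (suc j)) (fromℕ-nonNeg (suc j))
                                         (A≤H^ j m (ℕP.≤-trans (s≤s z≤n) 3≤m) m≤B) ⟩
         fromℕ (suc j) * H m ^ℚ j   ∎) ⟩
      recip m * (fromℕ (suc j) * H m ^ℚ j)
    ≡⟨ solve 3 (λ r c h → r :* (c :* h) := c :* (r :* h)) refl (recip m) (fromℕ (suc j)) (H m ^ℚ j) ⟩
      fromℕ (suc j) * (recip m * H m ^ℚ j)
    ≡⟨ when-true (ℕP.≤⇒≤ᵇ 3≤m) ⟨
      Φ j m
    ∎
    where open ℚP.≤-Reasoning

  compSumᴮ : ℕ → ℕ → ℚ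
  compSumᴮ k m = ∑ₗ (boxVecs k B) (λ v → when (valid m v) (prodRecip v))

  compSumᴮ≡S : ∀ k m → compSumᴮ k m ≡ S k m
  compSumᴮ≡S zero    zero    = ℚP.+-identityʳ 1ℚ
  compSumᴮ≡S zero    (suc m) = refl
  compSumᴮ≡S (suc k) m = trans (∑ₗ-boxVecs-suc k B _) (∑-cong (suc B) peel)
    where
    open ≡-Reasoning
    peel : ∀ a → ∑ₗ (boxVecs k B) (λ v → when (valid m (a ∷ v)) (recip a * prodRecip v))
               ≡ when (admissible a m) (recip a * S k (m ∸ a))
    peel a = begin
        ∑ₗ (boxVecs k B) (λ v → when (valid m (a ∷ v)) (recip a * prodRecip v))
      ≡⟨ ∑ₗ-cong (boxVecs k B) (λ v → trans (cong (λ b → when b (recip a * prodRecip v)) (valid-∷ a m v))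
                                            (sym (when-*-when (admissible a m) (recip a) _ _))) ⟩
        ∑ₗ (boxVecs k B) (λ v → when (admissible a m) (recip a * when (valid (m ∸ a) v) (prodRecip v)))
      ≡⟨ ∑ₗ-when (boxVecs k B) (admissible a m) _ ⟩
        when (admissible a m) (∑ₗ (boxVecs k B) (λ v → recip a * when (valid (m ∸ a) v) (prodRecip v)))
      ≡⟨ cong (when (admissible a m)) (∑ₗ-*ˡ (boxVecs k B) (recip a) _) ⟩
        when (admissible a m) (recip a * compSumᴮ k (m ∸ a))
      ≡⟨ cong (λ x → when (admissible a m) (recip a * x)) (compSumᴮ≡S k (m ∸ a)) ⟩
        when (admissible a m) (recip a * S k (m ∸ a))
      ∎

compSum≡S : ∀ k n → compSum k n ≡ Compositions.S n k n
compSum≡S k n = trans (∑ₗ-filter (valid n) (boxVecs k n) prodRecip) (Compositions.compSumᴮ≡S n k n)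

lemma5p2 : (k n : ℕ) → 1 ℕ.≤ k → 1 ℕ.≤ n → 3 ℕ.* k ℕ.≤ n →
    LeScaledLogPow (compSum k n) (fromℕ k * recip n) n (k ∸ 1)
lemma5p2 (suc j) n _ _ 3k≤n r 0≤r log<r = begin
    compSum (suc j) n
  ≡⟨ compSum≡S (suc j) n ⟩
    S (suc j) n
  ≤⟨ S-suc≤Φ j n ℕP.≤-refl ⟩
    Φ j n
  ≡⟨ when-true (ℕP.≤⇒≤ᵇ 3≤n) ⟩
    fromℕ (suc j) * (recip n * H n ^ℚ j)
  ≤⟨ *-monoˡ-≤-≥0 (fromℕ (suc j)) (fromℕ-nonNeg (suc j))
       (*-monoˡ-≤-≥0 (recip n) (recip-nonNeg n) (^-monoˡ-≤ j (H-nonNeg n) (H≤log 3≤n 0≤r log<r))) ⟩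
    fromℕ (suc j) * (recip n * r ^ℚ j)
  ≡⟨ ℚP.*-assoc (fromℕ (suc j)) (recip n) (r ^ℚ j) ⟨
    fromℕ (suc j) * recip n * r ^ℚ j
  ∎
  where
  open Compositions n
  open ℚP.≤-Reasoning
  3≤n : 3 ℕ.≤ n
  3≤n = ℕP.≤-trans (ℕP.*-monoʳ-≤ 3 {1} {suc j} (s≤s z≤n)) 3k≤n
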